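{- There exists an infinite sequence of graphs $G_1,G_2,\ldots$ with $|G_n|\to\infty$ such that $$\lim_{n\to\infty}\frac{Dyn_{\bar t=\epsilon(G_n)}(G_n)}{|G_n|}=1,$$ where $\epsilon(G_n)=|E(G_n)|/|G_n|$.
   Context: Graphs are finite, undirected, simple. A threshold assignment for $G$ is a function $\tau:V(G)\to\mathbb{N}\cup\{0\}$ with $\tau(v)\le \deg(v)$ for every $v$; its average threshold is $\sum_{v}\tau(v)/|G|$. For $M\subseteq V(G)$, the $\tau$-dynamic process starting from $M$ is $D_0=M$ and, for $i\ge0$, $D_{i+1}$ = set of vertices $v\notin D_0\cup\dots\cup D_i$ with at least $\tau(v)$ neighbours in $D_0\cup\dots\cup D_i$; $M$ is a $\tau$-dynamic monopoly if $\bigcup_i D_i=V(G)$. $dyn_\tau(G)$ is the minimum size of a $\tau$-dynamic monopoly, and $Dyn_{\bar t=t}(G)$ is the maximum of $dyn_\tau(G)$ over threshold assignments $\tau$ with average threshold $t$. -}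

module Defs where

open import Data.Nat using (ℕ; zero; suc; _+_; _≤_; _<ᵇ_; NonZero)
open import Data.Bool using (Bool; true; false; _∧_; _∨_; if_then_else_)
open import Data.Fin using (Fin; toℕ)
import Data.Fin as F
open import Data.Product using (Σ; ∃; ∃-syntax; _×_; _,_)
open import Data.Integer using (+_)
open import Data.Rational.Unnormalised using (ℚᵘ; _/_; _≃_)
open import Relation.Binary.PropositionalEquality using (_≡_)

record Graph : Set where
  field
    size   : ℕ
    adj    : Fin size → Fin size → Bool
    sym    : ∀ i j → adj i j ≡ adj j i
    irrefl : ∀ i → adj i i ≡ false
open Graph public

count : ∀ {n} → (Fin n → Bool) → ℕ
count {zero}  P = 0
count {suc n} P = (if P F.zero then 1 else 0) + count (λ i → P (F.suc i))

sumF : ∀ {n} → (Fin n → ℕ) → ℕ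
sumF {zero}  f = 0
sumF {suc n} f = f F.zero + sumF (λ i → f (F.suc i))

deg : (G : Graph) → Fin (size G) → ℕ
deg G v = count (adj G v)

numEdges : Graph → ℕ
numEdges G = sumF (λ i → count (λ j → adj G i j ∧ (toℕ i <ᵇ toℕ j)))

IsThreshold : (G : Graph) → (Fin (size G) → ℕ) → Set
IsThreshold G τ = ∀ v → τ v ≤ deg G v

avgThreshold : (G : Graph) .{{_ : NonZero (size G)}} → (Fin (size G) → ℕ) → ℚᵘ
avgThreshold G τ = + sumF τ / size G

edgeDensity : (G : Graph) .{{_ : NonZero (size G)}} → ℚᵘ
edgeDensity G = + numEdges G / size G

-- D_0 ∪ … ∪ D_i of the τ-dynamic process started from M
reached : (G : Graph) → (Fin (size G) → ℕ) → (Fin (size G) → Bool) → ℕ → Fin (size G) → Bool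
reached G τ M zero    v = M v
reached G τ M (suc i) v =
  reached G τ M i v ∨ (τ v Data.Nat.≤ᵇ count (λ u → adj G v u ∧ reached G τ M i u))

IsDynMonopoly : (G : Graph) → (Fin (size G) → ℕ) → (Fin (size G) → Bool) → Set
IsDynMonopoly G τ M = ∃[ i ] (∀ v → reached G τ M i v ≡ true)

IsDyn : (G : Graph) → (Fin (size G) → ℕ) → ℕ → Set
IsDyn G τ k =
  (∃[ M ] (IsDynMonopoly G τ M × count M ≡ k)) ×
  (∀ M → IsDynMonopoly G τ M → k ≤ count M)

IsDynAvg : (G : Graph) .{{_ : NonZero (size G)}} → ℚᵘ → ℕ → Set
IsDynAvg G t d =
  (∃[ τ ] (IsThreshold G τ × avgThreshold G τ ≃ t × IsDyn G τ d)) ×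
  (∀ τ k → IsThreshold G τ → avgThreshold G τ ≃ t → IsDyn G τ k → k ≤ d)

module Submission where

-- G_k is a clique K_h (the hub) together with h disjoint cliques K_d, where d = k + 1 and
-- h = 1 + d k, so that |E(G_k)| = d · h k.
-- Upper bound: in a clique K_s every threshold assignment t has a dynamic monopoly of size at most
-- Σ t / s (a vertex of threshold 0 activates for free, otherwise seed one of maximal threshold,
-- and recurse on the remaining clique with all thresholds lowered by one). Every component of G_k
-- has at least d vertices, so every τ of average ε(G_k) has a monopoly of size |E| / d = h k.
-- Lower bound: τ₀ = 0 on the hub and τ₀ = k = deg on the small cliques has average exactly ε(G_k);
-- two adjacent unseeded vertices of full threshold never activate, so each small clique needs
-- k seeds. Hence Dyn(G_k) / |G_k| = h k / (h (k + 2)) → 1.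

open import Defs hiding (sym)
open import Data.Nat using (ℕ; _≤_; NonZero)
open import Data.Product using (Σ; ∃; ∃-syntax; _×_; _,_; proj₁; proj₂)
open import Data.Integer using (+_)
open import Data.Rational.Unnormalised using (ℚᵘ; _/_; _<_; _-_; ∣_∣; 0ℚᵘ; 1ℚᵘ; _≃_)

import Data.Integer as ℤ
import Data.Integer.Properties as ℤ
import Data.Rational.Unnormalised as ℚ
import Data.Rational.Unnormalised.Properties as ℚ
open import Data.Bool using (Bool; true; false; not; _∧_; _∨_; if_then_else_)
open import Data.Bool.Properties using (∧-identityʳ; ∨-zeroʳ; T-≡)
open import Data.Fin using (Fin; zero; suc; toℕ; punchIn; punchOut; splitAt; _↑ˡ_; _↑ʳ_)
open import Data.Fin.Properties
  using (_≟_; any?; toℕ-injective; punchIn-punchOut; punchInᵢ≢i; punchIn-injective;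
         splitAt-↑ˡ; splitAt-↑ʳ; splitAt⁻¹-↑ˡ; splitAt⁻¹-↑ʳ)
open import Data.Nat as ℕ using (zero; suc; pred; _+_; _*_; _∸_; _<ᵇ_; _≤ᵇ_; z≤n; s≤s)
open import Data.Nat.Properties hiding (_≟_)
open import Data.Nat.Tactic.RingSolver using (solve-∀)
open import Data.Sum using (_⊎_; inj₁; inj₂)
open import Data.Vec.Functional using (_++_; insertAt)
open import Data.Vec.Functional.Properties using (lookup-++ˡ; lookup-++ʳ; insertAt-lookup; insertAt-punchIn)
open import Function using (_∘_; Equivalence)
open import Relation.Binary.PropositionalEquality
open import Relation.Nullary using (yes; no; does; contradiction)
open import Relation.Nullary.Decidable using (dec-true; dec-false)

↑-elim : ∀ {m n} {P : Fin (m ℕ.+ n) → Set} →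
         (∀ i → P (i ↑ˡ n)) → (∀ j → P (m ↑ʳ j)) → ∀ x → P x
↑-elim {m} {P = P} left right x with splitAt m x in eq
... | inj₁ i = subst P (splitAt⁻¹-↑ˡ eq) (left i)
... | inj₂ j = subst P (splitAt⁻¹-↑ʳ eq) (right j)

punchIn-elim : ∀ {n} {P : Fin (suc n) → Set} v → P v → (∀ j → P (punchIn v j)) → ∀ x → P x
punchIn-elim {P = P} v at-v elsewhere x with v ≟ x
... | yes refl = at-v
... | no v≢x   = subst P (punchIn-punchOut v≢x) (elsewhere (punchOut v≢x))

sumF-cong : ∀ {n} {f g : Fin n → ℕ} → (∀ i → f i ≡ g i) → sumF f ≡ sumF g
sumF-cong {zero}  f≗g = refl
sumF-cong {suc n} f≗g = cong₂ _+_ (f≗g zero) (sumF-cong (f≗g ∘ suc))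

sumF-const : ∀ n c → sumF {n} (λ _ → c) ≡ n * c
sumF-const zero    c = refl
sumF-const (suc n) c = cong (_+_ c) (sumF-const n c)

sumF-+ : ∀ {n} (f g : Fin n → ℕ) → sumF (λ i → f i + g i) ≡ sumF f + sumF g
sumF-+ {zero}  f g = refl
sumF-+ {suc n} f g = trans (cong (_+_ (f zero + g zero)) (sumF-+ (f ∘ suc) (g ∘ suc)))
                           (interchange (f zero) (g zero) _ _)
  where
  interchange : ∀ a b c e → (a + b) + (c + e) ≡ (a + c) + (b + e)
  interchange = solve-∀

sumF-++ : ∀ m {n} (f : Fin (m + n) → ℕ) → sumF f ≡ sumF (f ∘ (_↑ˡ n)) + sumF (f ∘ (m ↑ʳ_))
sumF-++ zero    f = refl
sumF-++ (suc m) f = trans (cong (_+_ (f zero)) (sumF-++ m (f ∘ suc))) (sym (+-assoc (f zero) _ _))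

sumF-punchIn : ∀ {n} (v : Fin (suc n)) (f : Fin (suc n) → ℕ) → sumF f ≡ f v + sumF (f ∘ punchIn v)
sumF-punchIn zero    f = refl
sumF-punchIn {suc n} (suc v) f =
  trans (cong (_+_ (f zero)) (sumF-punchIn v (f ∘ suc))) (x+[y+z]≡y+[x+z] (f zero) (f (suc v)) _)
  where
  x+[y+z]≡y+[x+z] : ∀ x y z → x + (y + z) ≡ y + (x + z)
  x+[y+z]≡y+[x+z] = solve-∀

sumF-swap : ∀ {m n} (f : Fin m → Fin n → ℕ) →
            sumF (λ i → sumF (f i)) ≡ sumF (λ j → sumF (λ i → f i j))
sumF-swap {zero}  {n} f = sym (trans (sumF-const n 0) (*-zeroʳ n))
sumF-swap {suc m} f =
  trans (cong (_+_ (sumF (f zero))) (sumF-swap (f ∘ suc)))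
        (sym (sumF-+ (f zero) (λ j → sumF (λ i → f (suc i) j))))

indicator : Bool → ℕ
indicator b = if b then 1 else 0

count≡sumF : ∀ {n} (P : Fin n → Bool) → count P ≡ sumF (indicator ∘ P)
count≡sumF {zero}  P = refl
count≡sumF {suc n} P = cong (_+_ (indicator (P zero))) (count≡sumF (P ∘ suc))

count-cong : ∀ {n} {P Q : Fin n → Bool} → (∀ i → P i ≡ Q i) → count P ≡ count Q
count-cong {zero}  P≗Q = refl
count-cong {suc n} P≗Q = cong₂ _+_ (cong indicator (P≗Q zero)) (count-cong (P≗Q ∘ suc))

count-const : ∀ n b → count {n} (λ _ → b) ≡ n * indicator b
count-const n b = trans (count≡sumF {n} (λ _ → b)) (sumF-const n (indicator b))

count-true : ∀ {n} {P : Fin n → Bool} → (∀ i → P i ≡ true) → count P ≡ n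
count-true {n} P≡true = trans (count-cong P≡true) (trans (count-const n true) (*-identityʳ n))

count-false : ∀ {n} {P : Fin n → Bool} → (∀ i → P i ≡ false) → count P ≡ 0
count-false {n} P≡false = trans (count-cong P≡false) (trans (count-const n false) (*-zeroʳ n))

count-mono : ∀ {n} {P Q : Fin n → Bool} → (∀ i → P i ≡ true → Q i ≡ true) → count P ≤ count Q
count-mono {zero}  P⊆Q = z≤n
count-mono {suc n} P⊆Q = +-mono-≤ (indicator-mono (P⊆Q zero)) (count-mono (P⊆Q ∘ suc))
  where
  indicator-mono : ∀ {a b} → (a ≡ true → b ≡ true) → indicator a ≤ indicator b
  indicator-mono {false}         _   = z≤n
  indicator-mono {true}  {false} a⇒b = contradiction (a⇒b refl) λ ()
  indicator-mono {true}  {true}  _   = ≤-refl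

count-++ : ∀ m {n} (P : Fin (m + n) → Bool) → count P ≡ count (P ∘ (_↑ˡ n)) + count (P ∘ (m ↑ʳ_))
count-++ m {n} P = trans (count≡sumF P) (trans (sumF-++ m (indicator ∘ P))
                     (sym (cong₂ _+_ (count≡sumF (P ∘ (_↑ˡ n))) (count≡sumF (P ∘ (m ↑ʳ_))))))

count-punchIn : ∀ {n} (v : Fin (suc n)) (P : Fin (suc n) → Bool) →
                count P ≡ indicator (P v) + count (P ∘ punchIn v)
count-punchIn v P = trans (count≡sumF P) (trans (sumF-punchIn v (indicator ∘ P))
                      (cong (_+_ (indicator (P v))) (sym (count≡sumF (P ∘ punchIn v)))))

count-split : ∀ {n} (P Q : Fin n → Bool) →
              count P ≡ count (λ i → P i ∧ Q i) + count (λ i → P i ∧ not (Q i))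
count-split P Q = begin
  count P                                                        ≡⟨ count≡sumF P ⟩
  sumF (indicator ∘ P)                                           ≡⟨ sumF-cong (λ i → split (P i) (Q i)) ⟩
  sumF (λ i → indicator (P i ∧ Q i) + indicator (P i ∧ not (Q i)))
    ≡⟨ sumF-+ (λ i → indicator (P i ∧ Q i)) _ ⟩
  sumF (λ i → indicator (P i ∧ Q i)) + sumF (λ i → indicator (P i ∧ not (Q i)))
    ≡⟨ sym (cong₂ _+_ (count≡sumF (λ i → P i ∧ Q i)) (count≡sumF (λ i → P i ∧ not (Q i)))) ⟩
  count (λ i → P i ∧ Q i) + count (λ i → P i ∧ not (Q i))        ∎
  where
  open ≡-Reasoning
  split : ∀ a b → indicator a ≡ indicator (a ∧ b) + indicator (a ∧ not b)
  split false b     = refl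
  split true  false = refl
  split true  true  = refl

count-∧true : ∀ {n} (P : Fin n → Bool) → count (λ i → P i ∧ true) ≡ count P
count-∧true P = count-cong (λ i → ∧-identityʳ (P i))

count-mono-< : ∀ {n} {P Q : Fin n → Bool} → (∀ i → P i ≡ true → Q i ≡ true) →
               ∀ y → Q y ≡ true → P y ≡ false → count P ℕ.< count Q
count-mono-< {suc n} {P} {Q} P⊆Q y Qy Py = begin-strict
  count P                          ≡⟨ count-punchIn y P ⟩
  indicator (P y) + count (P ∘ punchIn y) ≡⟨ cong (λ b → indicator b + count (P ∘ punchIn y)) Py ⟩
  count (P ∘ punchIn y)            ≤⟨ count-mono (P⊆Q ∘ punchIn y) ⟩
  count (Q ∘ punchIn y)            <⟨ n<1+n _ ⟩
  indicator true + count (Q ∘ punchIn y) ≡⟨ cong (λ b → indicator b + count (Q ∘ punchIn y)) Qy ⟨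
  indicator (Q y) + count (Q ∘ punchIn y) ≡⟨ count-punchIn y Q ⟨
  count Q                          ∎
  where open ≤-Reasoning

count-insertAt : ∀ {n} (M : Fin n → Bool) v b → count (insertAt M v b) ≡ indicator b + count M
count-insertAt M v b = trans (count-punchIn v (insertAt M v b))
  (cong₂ _+_ (cong indicator (insertAt-lookup M v b)) (count-cong (insertAt-punchIn M v b)))

sumF-pred : ∀ {n} (f : Fin n → ℕ) → sumF f ≡ sumF (pred ∘ f) + count (λ i → 0 <ᵇ f i)
sumF-pred f = begin
  sumF f                                                ≡⟨ sumF-cong (λ i → split (f i)) ⟩
  sumF (λ i → pred (f i) + indicator (0 <ᵇ f i))        ≡⟨ sumF-+ (pred ∘ f) _ ⟩
  sumF (pred ∘ f) + sumF (λ i → indicator (0 <ᵇ f i))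
    ≡⟨ cong (_+_ (sumF (pred ∘ f))) (count≡sumF (λ i → 0 <ᵇ f i)) ⟨
  sumF (pred ∘ f) + count (λ i → 0 <ᵇ f i)              ∎
  where
  open ≡-Reasoning
  split : ∀ n → n ≡ pred n + indicator (0 <ᵇ n)
  split zero    = refl
  split (suc n) = sym (+-comm n 1)

≤pred⇒< : ∀ {k n} → 1 ≤ n → k ≤ pred n → k ℕ.< n
≤pred⇒< {n = suc n} _ k≤n = s≤s k≤n

argmax : ∀ {n} (t : Fin (suc n) → ℕ) → ∃[ w ] (∀ x → t x ≤ t w)
argmax {zero}  t = zero , λ { zero → ≤-refl }
argmax {suc n} t with argmax (t ∘ suc)
... | w , max with ≤-total (t zero) (t (suc w))
...   | inj₁ t0≤tw = suc w , λ { zero → t0≤tw ; (suc x) → max x }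
...   | inj₂ tw≤t0 = zero  , λ { zero → ≤-refl ; (suc x) → ≤-trans (max x) tw≤t0 }

-- Complete graphs, disjoint unions and the handshake lemma

does-≟-sym : ∀ {n} (x y : Fin n) → does (x ≟ y) ≡ does (y ≟ x)
does-≟-sym x y with x ≟ y
... | yes x≡y = sym (dec-true (y ≟ x) (sym x≡y))
... | no  x≢y = sym (dec-false (y ≟ x) (x≢y ∘ sym))

does-≟-punchIn : ∀ {n} (v : Fin (suc n)) (i j : Fin n) →
                 does (punchIn v i ≟ punchIn v j) ≡ does (i ≟ j)
does-≟-punchIn v i j with i ≟ j
... | yes refl = dec-true (punchIn v i ≟ punchIn v i) refl
... | no  i≢j  = dec-false (punchIn v i ≟ punchIn v j) (i≢j ∘ punchIn-injective v i j)

complete : ℕ → Graph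
complete n = record
  { size   = n
  ; adj    = λ x y → not (does (x ≟ y))
  ; sym    = λ x y → cong not (does-≟-sym x y)
  ; irrefl = λ x → cong not (dec-true (x ≟ x) refl)
  }

complete-adj : ∀ {n} {x y : Fin n} → x ≢ y → adj (complete n) x y ≡ true
complete-adj {x = x} {y} x≢y = cong not (dec-false (x ≟ y) x≢y)

complete-adj-punchIn : ∀ {n} (v : Fin (suc n)) (i j : Fin n) →
                       adj (complete (suc n)) (punchIn v i) (punchIn v j) ≡ adj (complete n) i j
complete-adj-punchIn v i j = cong not (does-≟-punchIn v i j)

_⊕_ : Graph → Graph → Graph
G ⊕ H = record
  { size   = size G + size H
  ; adj    = λ x y → adj⊎ (splitAt (size G) x) (splitAt (size G) y)
  ; sym    = λ x y → adj⊎-sym (splitAt (size G) x) (splitAt (size G) y)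
  ; irrefl = λ x → adj⊎-irrefl (splitAt (size G) x)
  }
  where
  adj⊎ : Fin (size G) ⊎ Fin (size H) → Fin (size G) ⊎ Fin (size H) → Bool
  adj⊎ (inj₁ i) (inj₁ j) = adj G i j
  adj⊎ (inj₂ i) (inj₂ j) = adj H i j
  adj⊎ _        _        = false

  adj⊎-sym : ∀ x y → adj⊎ x y ≡ adj⊎ y x
  adj⊎-sym (inj₁ i) (inj₁ j) = Graph.sym G i j
  adj⊎-sym (inj₁ i) (inj₂ j) = refl
  adj⊎-sym (inj₂ i) (inj₁ j) = refl
  adj⊎-sym (inj₂ i) (inj₂ j) = Graph.sym H i j

  adj⊎-irrefl : ∀ x → adj⊎ x x ≡ false
  adj⊎-irrefl (inj₁ i) = irrefl G i
  adj⊎-irrefl (inj₂ j) = irrefl H j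

module _ (G H : Graph) where
  private
    a = size G
    b = size H

  ⊕-adjˡ : ∀ i j → adj (G ⊕ H) (i ↑ˡ b) (j ↑ˡ b) ≡ adj G i j
  ⊕-adjˡ i j rewrite splitAt-↑ˡ a i b | splitAt-↑ˡ a j b = refl

  ⊕-adjʳ : ∀ i j → adj (G ⊕ H) (a ↑ʳ i) (a ↑ʳ j) ≡ adj H i j
  ⊕-adjʳ i j rewrite splitAt-↑ʳ a b i | splitAt-↑ʳ a b j = refl

  ⊕-adjˡʳ : ∀ i j → adj (G ⊕ H) (i ↑ˡ b) (a ↑ʳ j) ≡ false
  ⊕-adjˡʳ i j rewrite splitAt-↑ˡ a i b | splitAt-↑ʳ a b j = refl

  ⊕-adjʳˡ : ∀ i j → adj (G ⊕ H) (a ↑ʳ i) (j ↑ˡ b) ≡ false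
  ⊕-adjʳˡ i j rewrite splitAt-↑ʳ a b i | splitAt-↑ˡ a j b = refl

  ⊕-neighboursˡ : ∀ (P : Fin (a + b) → Bool) i →
    count (λ u → adj (G ⊕ H) (i ↑ˡ b) u ∧ P u) ≡ count (λ j → adj G i j ∧ P (j ↑ˡ b))
  ⊕-neighboursˡ P i = trans (count-++ a (λ u → adj (G ⊕ H) (i ↑ˡ b) u ∧ P u)) (trans
    (cong₂ _+_ (count-cong (λ j → cong (_∧ P (j ↑ˡ b)) (⊕-adjˡ i j)))
               (count-false (λ j → cong (_∧ P (a ↑ʳ j)) (⊕-adjˡʳ i j))))
    (+-identityʳ _))

  ⊕-neighboursʳ : ∀ (P : Fin (a + b) → Bool) i →
    count (λ u → adj (G ⊕ H) (a ↑ʳ i) u ∧ P u) ≡ count (λ j → adj H i j ∧ P (a ↑ʳ j))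
  ⊕-neighboursʳ P i = trans (count-++ a (λ u → adj (G ⊕ H) (a ↑ʳ i) u ∧ P u))
    (cong₂ _+_ (count-false (λ j → cong (_∧ P (j ↑ˡ b)) (⊕-adjʳˡ i j)))
               (count-cong (λ j → cong (_∧ P (a ↑ʳ j)) (⊕-adjʳ i j))))

  ⊕-degˡ : ∀ i → deg (G ⊕ H) (i ↑ˡ b) ≡ deg G i
  ⊕-degˡ i = trans (sym (count-∧true (adj (G ⊕ H) (i ↑ˡ b))))
             (trans (⊕-neighboursˡ (λ _ → true) i) (count-∧true (adj G i)))

  ⊕-degʳ : ∀ i → deg (G ⊕ H) (a ↑ʳ i) ≡ deg H i
  ⊕-degʳ i = trans (sym (count-∧true (adj (G ⊕ H) (a ↑ʳ i))))
             (trans (⊕-neighboursʳ (λ _ → true) i) (count-∧true (adj H i)))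

  sumF-deg-⊕ : sumF (deg (G ⊕ H)) ≡ sumF (deg G) + sumF (deg H)
  sumF-deg-⊕ = trans (sumF-++ a (deg (G ⊕ H))) (cong₂ _+_ (sumF-cong ⊕-degˡ) (sumF-cong ⊕-degʳ))

copies : ℕ → Graph → Graph
copies zero    G = complete 0
copies (suc m) G = G ⊕ copies m G

size-copies : ∀ m G → size (copies m G) ≡ m * size G
size-copies zero    G = refl
size-copies (suc m) G = cong (_+_ (size G)) (size-copies m G)

IsRegular : ℕ → Graph → Set
IsRegular r G = ∀ x → deg G x ≡ r

complete-regular : ∀ n → IsRegular (pred n) (complete n)
complete-regular (suc n) x = begin
  count (λ y → not (does (x ≟ y)))                  ≡⟨ count-punchIn x (λ y → not (does (x ≟ y))) ⟩
  indicator (not (does (x ≟ x))) + count (λ j → not (does (x ≟ punchIn x j)))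
    ≡⟨ cong₂ _+_ (cong (indicator ∘ not) (dec-true (x ≟ x) refl))
                 (count-true {P = λ j → not (does (x ≟ punchIn x j))}
                             (λ j → complete-adj (punchInᵢ≢i x j ∘ sym))) ⟩
  n ∎
  where open ≡-Reasoning

⊕-regular : ∀ {r G H} → IsRegular r G → IsRegular r H → IsRegular r (G ⊕ H)
⊕-regular {G = G} {H} regG regH = ↑-elim (λ i → trans (⊕-degˡ G H i) (regG i))
                                         (λ j → trans (⊕-degʳ G H j) (regH j))

copies-regular : ∀ {r G} m → IsRegular r G → IsRegular r (copies m G)
copies-regular zero    regG ()
copies-regular (suc m) regG = ⊕-regular regG (copies-regular m regG)

sumF-deg-regular : ∀ {r} G → IsRegular r G → sumF (deg G) ≡ size G * r
sumF-deg-regular {r} G regG = trans (sumF-cong regG) (sumF-const (size G) r)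

not-<ᵇ : ∀ {m n} → m ≢ n → not (m <ᵇ n) ≡ (n <ᵇ m)
not-<ᵇ {zero}  {zero}  m≢n = contradiction refl m≢n
not-<ᵇ {zero}  {suc n} _   = refl
not-<ᵇ {suc m} {zero}  _   = refl
not-<ᵇ {suc m} {suc n} m≢n = not-<ᵇ (m≢n ∘ cong suc)

handshake : ∀ G → sumF (deg G) ≡ numEdges G + numEdges G
handshake G = begin
  sumF (deg G)
    ≡⟨ sumF-cong (λ i → count-split (adj G i) (lt i)) ⟩
  sumF (λ i → count (λ j → adj G i j ∧ lt i j) + count (λ j → adj G i j ∧ not (lt i j)))
    ≡⟨ sumF-+ (λ i → count (λ j → adj G i j ∧ lt i j)) _ ⟩
  numEdges G + sumF (λ i → count (λ j → adj G i j ∧ not (lt i j)))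
    ≡⟨ cong (_+_ (numEdges G))
            (sumF-cong (λ i → trans (count-cong (reversed i)) (count≡sumF (λ j → adj G i j ∧ lt j i)))) ⟩
  numEdges G + sumF (λ i → sumF (λ j → indicator (adj G i j ∧ lt j i)))
    ≡⟨ cong (_+_ (numEdges G)) (sumF-swap (λ i j → indicator (adj G i j ∧ lt j i))) ⟩
  numEdges G + sumF (λ j → sumF (λ i → indicator (adj G i j ∧ lt j i)))
    ≡⟨ cong (_+_ (numEdges G)) (sumF-cong (λ j → trans
         (sumF-cong (λ i → cong (λ e → indicator (e ∧ lt j i)) (Graph.sym G i j)))
         (sym (count≡sumF (λ i → adj G j i ∧ lt j i))))) ⟩
  numEdges G + numEdges G ∎
  where
  open ≡-Reasoning
  lt : Fin (size G) → Fin (size G) → Bool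
  lt i j = toℕ i <ᵇ toℕ j
  reversed : ∀ i j → (adj G i j ∧ not (lt i j)) ≡ (adj G i j ∧ lt j i)
  reversed i j with adj G i j in i~j
  ... | false = refl
  ... | true  = not-<ᵇ (λ i≡j → distinct (toℕ-injective i≡j))
    where
    distinct : i ≢ j
    distinct refl = contradiction (trans (sym i~j) (irrefl G i)) λ ()

-- The dynamic process

≤⇒≤ᵇ≡true : ∀ {m n} → m ≤ n → (m ≤ᵇ n) ≡ true
≤⇒≤ᵇ≡true = Equivalence.to T-≡ ∘ ≤⇒≤ᵇ

<⇒≤ᵇ≡false : ∀ {m n} → n ℕ.< m → (m ≤ᵇ n) ≡ false
<⇒≤ᵇ≡false {m} {n} n<m with m ≤ᵇ n in m≤ᵇn
... | false = refl
... | true  = contradiction (≤ᵇ⇒≤ m n (Equivalence.from T-≡ m≤ᵇn)) (<⇒≱ n<m)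

<ᵇ≡true⇒< : ∀ {m n} → (m <ᵇ n) ≡ true → m ℕ.< n
<ᵇ≡true⇒< {m} {n} m<ᵇn = <ᵇ⇒< m n (Equivalence.from T-≡ m<ᵇn)

∧≡true⇒ : ∀ {a b} → (a ∧ b) ≡ true → a ≡ true × b ≡ true
∧≡true⇒ {true} {true} _ = refl , refl

lowerNeighbours : (G : Graph) → (Fin (size G) → ℕ) → Fin (size G) → ℕ
lowerNeighbours G ρ v = count (λ u → adj G v u ∧ (ρ u <ᵇ ρ v))

module _ {G : Graph} {τ : Fin (size G) → ℕ} {M : Fin (size G) → Bool} where

  reached-suc : ∀ {r v} → reached G τ M r v ≡ true → reached G τ M (suc r) v ≡ true
  reached-suc {r} {v} reached-r =
    cong (_∨ (τ v ≤ᵇ count (λ u → adj G v u ∧ reached G τ M r u))) reached-r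

  reached-seed : ∀ {v} → M v ≡ true → ∀ r → reached G τ M r v ≡ true
  reached-seed Mv zero    = Mv
  reached-seed Mv (suc r) = reached-suc {r} (reached-seed Mv r)

  reached-mono : ∀ {r s v} → r ≤ s → reached G τ M r v ≡ true → reached G τ M s v ≡ true
  reached-mono {r} {s} {v} r≤s reached-r =
    subst (λ t → reached G τ M t v ≡ true) (m∸n+n≡m r≤s) (later (s ∸ r))
    where
    later : ∀ o → reached G τ M (o + r) v ≡ true
    later zero    = reached-r
    later (suc o) = reached-suc {o + r} (later o)

  IsRanking : (Fin (size G) → ℕ) → Set
  IsRanking ρ = ∀ v → M v ≡ true ⊎ τ v ≤ lowerNeighbours G ρ v

  -- A vertex of rank at most r is active after r + 1 rounds.
  ranking⇒dynMonopoly : ∀ ρ → IsRanking ρ → IsDynMonopoly G τ M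
  ranking⇒dynMonopoly ρ ranked = suc (sumF ρ) , λ v → reachedBy (sumF ρ) v (sumF-term v)
    where
    sumF-term : ∀ {n} {f : Fin n → ℕ} i → f i ≤ sumF f
    sumF-term zero    = m≤m+n _ _
    sumF-term (suc i) = ≤-trans (sumF-term i) (m≤n+m _ _)

    reachedBy  : ∀ r v → ρ v ≤ r → reached G τ M (suc r) v ≡ true
    reachedBelow : ∀ r u → ρ u ℕ.< r → reached G τ M r u ≡ true

    reachedBelow (suc r) u (s≤s ρu≤r) = reachedBy r u ρu≤r

    reachedBy r v ρv≤r with ranked v
    ... | inj₁ Mv  = reached-seed Mv (suc r)
    ... | inj₂ τv≤ =
      trans (cong (reached G τ M r v ∨_) (≤⇒≤ᵇ≡true (≤-trans τv≤ (count-mono earlier)))) (∨-zeroʳ _)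
      where
      earlier : ∀ u → (adj G v u ∧ (ρ u <ᵇ ρ v)) ≡ true → (adj G v u ∧ reached G τ M r u) ≡ true
      earlier u v~u∧ρu<ρv with ∧≡true⇒ {adj G v u} v~u∧ρu<ρv
      ... | v~u , ρu<ρv = cong₂ _∧_ v~u (reachedBelow r u (<-≤-trans (<ᵇ≡true⇒< ρu<ρv) ρv≤r))

  -- Two adjacent unseeded vertices whose thresholds are their degrees wait for each other forever.
  dynMonopoly-covers-saturated-edge : IsDynMonopoly G τ M → ∀ {x y} → adj G x y ≡ true →
    deg G x ≤ τ x → deg G y ≤ τ y → M x ≡ true ⊎ M y ≡ true
  dynMonopoly-covers-saturated-edge (r , all-reached) {x} {y} x~y saturated-x saturated-y
    with M x in Mx | M y in My
  ... | true  | _     = inj₁ refl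
  ... | false | true  = inj₂ refl
  ... | false | false = contradiction (trans (sym (all-reached x)) (proj₁ (neverReached r))) λ ()
    where
    stuck : ∀ {s t} → adj G s t ≡ true → deg G s ≤ τ s → ∀ k → reached G τ M k t ≡ false →
            (τ s ≤ᵇ count (λ u → adj G s u ∧ reached G τ M k u)) ≡ false
    stuck {s} {t} s~t saturated-s k unreached-t = <⇒≤ᵇ≡false (<-≤-trans
      (count-mono-< (λ u → proj₁ ∘ ∧≡true⇒) t s~t (cong₂ _∧_ s~t unreached-t)) saturated-s)

    neverReached : ∀ k → reached G τ M k x ≡ false × reached G τ M k y ≡ false
    neverReached zero = Mx , My
    neverReached (suc k) with neverReached k
    ... | unreached-x , unreached-y =
      cong₂ _∨_ unreached-x (stuck x~y saturated-x k unreached-y) ,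
      cong₂ _∨_ unreached-y (stuck (trans (Graph.sym G y x) x~y) saturated-y k unreached-x)

module _ (G H : Graph) (τ : Fin (size G + size H) → ℕ) (M : Fin (size G + size H) → Bool) where
  private
    a = size G
    b = size H

  reached-⊕ˡ : ∀ {M₁} → (∀ i → M (i ↑ˡ b) ≡ M₁ i) →
               ∀ r i → reached (G ⊕ H) τ M r (i ↑ˡ b) ≡ reached G (τ ∘ (_↑ˡ b)) M₁ r i
  reached-⊕ˡ M≗M₁ zero    i = M≗M₁ i
  reached-⊕ˡ M≗M₁ (suc r) i = cong₂ _∨_ (reached-⊕ˡ M≗M₁ r i) (cong (τ (i ↑ˡ b) ≤ᵇ_)
    (trans (⊕-neighboursˡ G H (reached (G ⊕ H) τ M r) i)
           (count-cong (λ j → cong (adj G i j ∧_) (reached-⊕ˡ M≗M₁ r j)))))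

  reached-⊕ʳ : ∀ {M₂} → (∀ j → M (a ↑ʳ j) ≡ M₂ j) →
               ∀ r j → reached (G ⊕ H) τ M r (a ↑ʳ j) ≡ reached H (τ ∘ (a ↑ʳ_)) M₂ r j
  reached-⊕ʳ M≗M₂ zero    j = M≗M₂ j
  reached-⊕ʳ M≗M₂ (suc r) j = cong₂ _∨_ (reached-⊕ʳ M≗M₂ r j) (cong (τ (a ↑ʳ j) ≤ᵇ_)
    (trans (⊕-neighboursʳ G H (reached (G ⊕ H) τ M r) j)
           (count-cong (λ i → cong (adj H j i ∧_) (reached-⊕ʳ M≗M₂ r i)))))

⊕-dynMonopoly : ∀ {G H} τ {M₁ M₂} →
  IsDynMonopoly G (τ ∘ (_↑ˡ size H)) M₁ → IsDynMonopoly H (τ ∘ (size G ↑ʳ_)) M₂ →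
  IsDynMonopoly (G ⊕ H) τ (M₁ ++ M₂)
⊕-dynMonopoly {G} {H} τ {M₁} {M₂} (r₁ , all₁) (r₂ , all₂) = r₁ ℕ.⊔ r₂ , ↑-elim
  (λ i → reached-mono (m≤m⊔n r₁ r₂)
           (trans (reached-⊕ˡ G H τ (M₁ ++ M₂) (lookup-++ˡ M₁ M₂) r₁ i) (all₁ i)))
  (λ j → reached-mono (m≤n⊔m r₁ r₂)
           (trans (reached-⊕ʳ G H τ (M₁ ++ M₂) (lookup-++ʳ M₁ M₂) r₂ j) (all₂ j)))

-- Dynamic monopolies of cliques

record CompleteSeeding (s : ℕ) (t : Fin s → ℕ) : Set where
  field
    seeds        : Fin s → Bool
    rank         : Fin s → ℕ
    ranking      : IsRanking {complete s} {t} {seeds} rank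
    cost         : s * count seeds ≤ sumF t
    -- the two invariants that let the induction in completeSeeding bound the cost
    seeds-pos    : ∀ x → seeds x ≡ true → 1 ≤ t x
    count-≤-max  : ∀ B → (∀ x → t x ≤ B) → count seeds ≤ B

-- A seeding of K_{s+1} from one of K_s: v gets the smallest rank, so each other vertex
-- already has v as an active neighbour and its threshold drops by one.
module ExtendSeeding {s} (t : Fin (suc s) → ℕ) (v : Fin (suc s))
            (S : CompleteSeeding s (λ j → pred (t (punchIn v j)))) where
  open CompleteSeeding S

  rank⁺ : Fin (suc s) → ℕ
  rank⁺ = insertAt (suc ∘ rank) v 0

  lowerNeighbours-punchIn : ∀ j →
    lowerNeighbours (complete (suc s)) rank⁺ (punchIn v j) ≡ suc (lowerNeighbours (complete s) rank j)
  lowerNeighbours-punchIn j =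
    trans (count-punchIn v (λ u → adj K (punchIn v j) u ∧ (rank⁺ u <ᵇ rank⁺ (punchIn v j))))
          (cong₂ _+_ (cong indicator at-v) (count-cong at-punchIn))
    where
    K = complete (suc s)
    at-v : (adj K (punchIn v j) v ∧ (rank⁺ v <ᵇ rank⁺ (punchIn v j))) ≡ true
    at-v rewrite insertAt-lookup (suc ∘ rank) v 0 | insertAt-punchIn (suc ∘ rank) v 0 j =
      trans (∧-identityʳ _) (complete-adj (punchInᵢ≢i v j))
    at-punchIn : ∀ i → (adj K (punchIn v j) (punchIn v i) ∧ (rank⁺ (punchIn v i) <ᵇ rank⁺ (punchIn v j)))
                       ≡ (adj (complete s) j i ∧ (rank i <ᵇ rank j))
    at-punchIn i = cong₂ _∧_ (complete-adj-punchIn v j i)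
      (cong₂ _<ᵇ_ (insertAt-punchIn (suc ∘ rank) v 0 i) (insertAt-punchIn (suc ∘ rank) v 0 j))

  ranking⁺-punchIn : ∀ b j → insertAt seeds v b (punchIn v j) ≡ true ⊎
                             t (punchIn v j) ≤ lowerNeighbours (complete (suc s)) rank⁺ (punchIn v j)
  ranking⁺-punchIn b j with ranking j
  ... | inj₁ seed = inj₁ (trans (insertAt-punchIn seeds v b j) seed)
  ... | inj₂ t≤   =
    inj₂ (≤-trans (≤-trans (n≤1+pred _) (s≤s t≤)) (≤-reflexive (sym (lowerNeighbours-punchIn j))))
    where
    n≤1+pred : ∀ n → n ≤ suc (pred n)
    n≤1+pred zero    = z≤n
    n≤1+pred (suc n) = ≤-refl

  ranking⁺ : ∀ b → b ≡ true ⊎ t v ≡ 0 → IsRanking {complete (suc s)} {t} {insertAt seeds v b} rank⁺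
  ranking⁺ b (inj₁ b≡true) =
    punchIn-elim v (inj₁ (trans (insertAt-lookup seeds v b) b≡true)) (ranking⁺-punchIn b)
  ranking⁺ b (inj₂ tv≡0) =
    punchIn-elim v (inj₂ (subst (_≤ lowerNeighbours (complete (suc s)) rank⁺ v) (sym tv≡0) z≤n))
                   (ranking⁺-punchIn b)

  unseeded : t v ≡ 0 → CompleteSeeding (suc s) t
  unseeded tv≡0 = record
    { seeds       = insertAt seeds v false
    ; rank        = rank⁺
    ; ranking     = ranking⁺ false (inj₂ tv≡0)
    ; cost        = subst (_≤ sumF t) (cong (suc s *_) (sym (count-insertAt seeds v false))) cost⁺
    ; seeds-pos   = punchIn-elim v
        (λ seed → contradiction (trans (sym (insertAt-lookup seeds v false)) seed) λ ())
        (λ j seed → ≤-trans (seeds-pos j (trans (sym (insertAt-punchIn seeds v false j)) seed)) pred[n]≤n)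
    ; count-≤-max = λ B t≤B → ≤-trans (≤-reflexive (count-insertAt seeds v false))
                      (≤-trans (count-≤-max (pred B) (λ j → pred-mono-≤ (t≤B (punchIn v j)))) pred[n]≤n)
    }
    where
    positive : ∀ j → seeds j ≡ true → (0 <ᵇ t (punchIn v j)) ≡ true
    positive j seed with t (punchIn v j) | seeds-pos j seed
    ... | suc (suc _) | _ = refl
    cost⁺ : suc s * count seeds ≤ sumF t
    cost⁺ = begin
      count seeds + s * count seeds
        ≤⟨ +-mono-≤ (count-mono positive) cost ⟩
      count (λ j → 0 <ᵇ t (punchIn v j)) + sumF (λ j → pred (t (punchIn v j)))
        ≡⟨ +-comm (count (λ j → 0 <ᵇ t (punchIn v j))) _ ⟩
      sumF (λ j → pred (t (punchIn v j))) + count (λ j → 0 <ᵇ t (punchIn v j))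
        ≡⟨ sumF-pred (t ∘ punchIn v) ⟨
      sumF (t ∘ punchIn v)
        ≡⟨ cong (_+ sumF (t ∘ punchIn v)) tv≡0 ⟨
      t v + sumF (t ∘ punchIn v)
        ≡⟨ sumF-punchIn v t ⟨
      sumF t ∎
      where open ≤-Reasoning

  seeded : (∀ x → t x ≤ t v) → (∀ x → 1 ≤ t x) → CompleteSeeding (suc s) t
  seeded max positive = record
    { seeds       = insertAt seeds v true
    ; rank        = rank⁺
    ; ranking     = ranking⁺ true (inj₁ refl)
    ; cost        = subst (_≤ sumF t) (cong (suc s *_) (sym (count-insertAt seeds v true))) cost⁺
    ; seeds-pos   = λ x _ → positive x
    ; count-≤-max = λ B t≤B → ≤-trans (≤-reflexive (count-insertAt seeds v true)) (≤-trans count<tv (t≤B v))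
    }
    where
    count<tv : count seeds ℕ.< t v
    count<tv = ≤pred⇒< (positive v) (count-≤-max (pred (t v)) (λ j → pred-mono-≤ (max (punchIn v j))))
    cost⁺ : suc s * suc (count seeds) ≤ sumF t
    cost⁺ = begin
      suc s * suc (count seeds)
        ≡⟨ expand s (count seeds) ⟩
      suc (count seeds) + (s * count seeds + s)
        ≤⟨ +-mono-≤ count<tv (+-monoˡ-≤ s cost) ⟩
      t v + (sumF (λ j → pred (t (punchIn v j))) + s)
        ≡⟨ cong (λ c → t v + (sumF (λ j → pred (t (punchIn v j))) + c))
                (count-true {P = λ j → 0 <ᵇ t (punchIn v j)} (λ j → positive⇒ (positive (punchIn v j)))) ⟨
      t v + (sumF (λ j → pred (t (punchIn v j))) + count (λ j → 0 <ᵇ t (punchIn v j)))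
        ≡⟨ cong (_+_ (t v)) (sumF-pred (t ∘ punchIn v)) ⟨
      t v + sumF (t ∘ punchIn v)
        ≡⟨ sumF-punchIn v t ⟨
      sumF t ∎
      where
      open ≤-Reasoning
      expand : ∀ s k → suc s * suc k ≡ suc k + (s * k + s)
      expand = solve-∀
      positive⇒ : ∀ {n} → 1 ≤ n → (0 <ᵇ n) ≡ true
      positive⇒ (s≤s _) = refl

completeSeeding : ∀ s (t : Fin s → ℕ) → CompleteSeeding s t
completeSeeding zero t = record
  { seeds = λ () ; rank = λ () ; ranking = λ () ; cost = z≤n ; seeds-pos = λ () ; count-≤-max = λ _ _ → z≤n }
completeSeeding (suc s) t with any? (λ x → t x ℕ.≟ 0)
... | yes (v , tv≡0) = ExtendSeeding.unseeded t v (completeSeeding s _) tv≡0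
... | no  no-zero    =
  ExtendSeeding.seeded t w (completeSeeding s _) max (λ x → n≢0⇒n>0 (λ tx≡0 → no-zero (x , tx≡0)))
  where
  w   = proj₁ (argmax t)
  max = proj₂ (argmax t)

-- Disjoint unions of cliques

HasSmallDynMonopolies : ℕ → Graph → Set
HasSmallDynMonopolies d G = ∀ τ → ∃[ M ] (IsDynMonopoly G τ M × d * count M ≤ sumF τ)

complete-smallDynMonopolies : ∀ {d s} → d ≤ s → HasSmallDynMonopolies d (complete s)
complete-smallDynMonopolies {d} {s} d≤s τ =
  seeds , ranking⇒dynMonopoly rank ranking , ≤-trans (*-monoˡ-≤ (count seeds) d≤s) cost
  where open CompleteSeeding (completeSeeding s τ)

⊕-smallDynMonopolies : ∀ {d G H} → HasSmallDynMonopolies d G → HasSmallDynMonopolies d H →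
                       HasSmallDynMonopolies d (G ⊕ H)
⊕-smallDynMonopolies {d} {G} {H} smallG smallH τ
  with smallG (τ ∘ (_↑ˡ size H)) | smallH (τ ∘ (size G ↑ʳ_))
... | M₁ , monopoly₁ , cost₁ | M₂ , monopoly₂ , cost₂ =
  M₁ ++ M₂ , ⊕-dynMonopoly τ monopoly₁ monopoly₂ , (begin
    d * count (M₁ ++ M₂)
      ≡⟨ cong (d *_) (trans (count-++ (size G) (M₁ ++ M₂))
                            (cong₂ _+_ (count-cong (lookup-++ˡ M₁ M₂)) (count-cong (lookup-++ʳ M₁ M₂)))) ⟩
    d * (count M₁ + count M₂)         ≡⟨ *-distribˡ-+ d (count M₁) (count M₂) ⟩
    d * count M₁ + d * count M₂       ≤⟨ +-mono-≤ cost₁ cost₂ ⟩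
    sumF (τ ∘ (_↑ˡ size H)) + sumF (τ ∘ (size G ↑ʳ_)) ≡⟨ sumF-++ (size G) τ ⟨
    sumF τ ∎)
  where open ≤-Reasoning

copies-smallDynMonopolies : ∀ {d G} m → HasSmallDynMonopolies d G → HasSmallDynMonopolies d (copies m G)
copies-smallDynMonopolies {d} zero    smallG τ = (λ ()) , (0 , λ ()) , ≤-reflexive (*-zeroʳ d)
copies-smallDynMonopolies {d} (suc m) smallG   =
  ⊕-smallDynMonopolies {d} smallG (copies-smallDynMonopolies {d} m smallG)

IsVertexCover : (G : Graph) → (Fin (size G) → Bool) → Set
IsVertexCover G C = ∀ x y → adj G x y ≡ true → C x ≡ true ⊎ C y ≡ true

complete-vertexCover : ∀ n C → IsVertexCover (complete (suc n)) C → n ≤ count C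
complete-vertexCover zero    C cover = z≤n
complete-vertexCover (suc n) C cover with C zero in C0
... | true  = s≤s (complete-vertexCover n (C ∘ suc) λ x y x~y → cover (suc x) (suc y) x~y)
... | false = ≤-reflexive (sym (count-true others))
  where
  others : ∀ j → C (suc j) ≡ true
  others j with cover zero (suc j) refl
  ... | inj₁ C0≡true = contradiction (trans (sym C0) C0≡true) λ ()
  ... | inj₂ Cj      = Cj

⊕-vertexCover : ∀ {G H C} → IsVertexCover (G ⊕ H) C →
  IsVertexCover G (C ∘ (_↑ˡ size H)) × IsVertexCover H (C ∘ (size G ↑ʳ_))
⊕-vertexCover {G} {H} cover =
  (λ x y x~y → cover _ _ (trans (⊕-adjˡ G H x y) x~y)) ,
  (λ x y x~y → cover _ _ (trans (⊕-adjʳ G H x y) x~y))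

copies-complete-vertexCover : ∀ m n C → IsVertexCover (copies m (complete (suc n))) C → m * n ≤ count C
copies-complete-vertexCover zero    n C cover = z≤n
copies-complete-vertexCover (suc m) n C cover =
  subst (suc m * n ≤_) (sym (count-++ (suc n) C))
    (+-mono-≤ (complete-vertexCover n _ (proj₁ (⊕-vertexCover cover)))
              (copies-complete-vertexCover m n _ (proj₂ (⊕-vertexCover cover))))

-- The extremal family

/-≃-injective : ∀ a b n → (+ a / suc n) ≃ (+ b / suc n) → a ≡ b
/-≃-injective a b n (ℚ.*≡* eq) = *-cancelʳ-≡ a b (suc n)
  (ℤ.+-injective (trans (ℤ.pos-* a (suc n)) (trans eq (sym (ℤ.pos-* b (suc n))))))

∣n/N-1∣< : ∀ n N .{{_ : NonZero N}} p q → n ≤ N → (N ∸ n) * suc q ℕ.< N →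
           ∣ (+ n / N) - 1ℚᵘ ∣ < ℚ.mkℚᵘ ℤ.+[1+ p ] q
∣n/N-1∣< n (suc N) p q n≤N gap = ℚ.*<* (subst₂ ℤ._<_
  (trans (ℤ.pos-* (suc N ∸ n) (suc q)) (cong (λ m → + m ℤ.* + suc q) (sym distance)))
  (ℤ.pos-* (suc p) (suc (N * 1)))
  (ℤ.+<+ (<-≤-trans gap
    (subst (λ m → suc N ≤ suc p * suc m) (sym (*-identityʳ N)) (m≤n*m (suc N) (suc p))))))
  where
  distance : ℤ.∣ + n ℤ.* + 1 ℤ.+ ℤ.-[1+ 0 ] ℤ.* + suc N ∣ ≡ suc N ∸ n
  distance = begin
    ℤ.∣ + n ℤ.* + 1 ℤ.+ ℤ.-[1+ 0 ] ℤ.* + suc N ∣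
      ≡⟨ cong ℤ.∣_∣ (cong₂ ℤ._+_ (ℤ.*-identityʳ (+ n)) (ℤ.-1*i≡-i (+ suc N))) ⟩
    ℤ.∣ + n ℤ.- + suc N ∣  ≡⟨ cong ℤ.∣_∣ (ℤ.m-n≡m⊖n n (suc N)) ⟩
    ℤ.∣ n ℤ.⊖ suc N ∣      ≡⟨ ℤ.∣m⊖n∣≡∣n⊖m∣ n (suc N) ⟩
    ℤ.∣ suc N ℤ.⊖ n ∣      ≡⟨ cong ℤ.∣_∣ (ℤ.⊖-≥ n≤N) ⟩
    suc N ∸ n ∎
    where open ≡-Reasoning

module Construction (k : ℕ) where
  d h D : ℕ
  d = suc k
  h = suc (d * k)
  D = h * k

  smallCliques graph : Graph
  smallCliques = copies h (complete d)
  graph        = complete h ⊕ smallCliques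

  hubVertex : Fin h → Fin (size graph)
  hubVertex = _↑ˡ size smallCliques

  cliqueVertex : Fin (size smallCliques) → Fin (size graph)
  cliqueVertex = h ↑ʳ_

  numEdges-graph : numEdges graph ≡ d * D
  numEdges-graph = *-cancelˡ-≡ (numEdges graph) (d * D) 2 (begin
    2 * numEdges graph                      ≡⟨ twice (numEdges graph) ⟨
    numEdges graph + numEdges graph         ≡⟨ handshake graph ⟨
    sumF (deg graph)                        ≡⟨ sumF-deg-⊕ (complete h) smallCliques ⟩
    sumF (deg (complete h)) + sumF (deg smallCliques)
      ≡⟨ cong₂ _+_ (sumF-deg-regular (complete h) (complete-regular h))
                   (trans (sumF-deg-regular smallCliques (copies-regular h (complete-regular d)))
                          (cong (_* k) (size-copies h (complete d)))) ⟩
    h * (d * k) + (h * d) * k               ≡⟨ arrange h d k ⟩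
    2 * (d * D) ∎)
    where
    open ≡-Reasoning
    twice : ∀ n → n + n ≡ 2 * n
    twice = solve-∀
    arrange : ∀ h d k → h * (d * k) + (h * d) * k ≡ 2 * (d * (h * k))
    arrange = solve-∀

  avg≃density⇒sum≡edges : ∀ τ → avgThreshold graph τ ≃ edgeDensity graph → sumF τ ≡ numEdges graph
  avg≃density⇒sum≡edges τ = /-≃-injective (sumF τ) (numEdges graph) _

  sum≡edges⇒avg≃density : ∀ τ → sumF τ ≡ numEdges graph → avgThreshold graph τ ≃ edgeDensity graph
  sum≡edges⇒avg≃density τ sum≡edges =
    subst (λ e → (+ e / size graph) ≃ edgeDensity graph) (sym sum≡edges) ℚ.≃-refl

  deg-cliqueVertex : ∀ j → deg graph (cliqueVertex j) ≡ k
  deg-cliqueVertex j = trans (⊕-degʳ (complete h) smallCliques j)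
                             (copies-regular h (complete-regular d) j)

  τ₀-hub : Fin h → ℕ
  τ₀-hub _ = 0

  τ₀-cliques : Fin (size smallCliques) → ℕ
  τ₀-cliques _ = k

  τ₀ : Fin (size graph) → ℕ
  τ₀ = τ₀-hub ++ τ₀-cliques

  τ₀-threshold : IsThreshold graph τ₀
  τ₀-threshold = ↑-elim
    (λ i → subst (_≤ deg graph (hubVertex i)) (sym (lookup-++ˡ τ₀-hub τ₀-cliques i)) z≤n)
    (λ j → ≤-reflexive (trans (lookup-++ʳ τ₀-hub τ₀-cliques j) (sym (deg-cliqueVertex j))))

  sumF-τ₀ : sumF τ₀ ≡ numEdges graph
  sumF-τ₀ = begin
    sumF τ₀                                           ≡⟨ sumF-++ h τ₀ ⟩
    sumF (τ₀ ∘ hubVertex) + sumF (τ₀ ∘ cliqueVertex)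
      ≡⟨ cong₂ _+_ (sumF-cong (lookup-++ˡ τ₀-hub τ₀-cliques))
                   (sumF-cong (lookup-++ʳ τ₀-hub τ₀-cliques)) ⟩
    sumF τ₀-hub + sumF τ₀-cliques
      ≡⟨ cong₂ _+_ (sumF-const h 0)
                   (trans (sumF-const (size smallCliques) k) (cong (_* k) (size-copies h (complete d)))) ⟩
    h * 0 + (h * d) * k                               ≡⟨ arrange h d k ⟩
    d * D                                             ≡⟨ numEdges-graph ⟨
    numEdges graph ∎
    where
    open ≡-Reasoning
    arrange : ∀ h d k → h * 0 + (h * d) * k ≡ d * (h * k)
    arrange = solve-∀

  small-monopolies : HasSmallDynMonopolies d graph
  small-monopolies = ⊕-smallDynMonopolies {d} {complete h} {smallCliques}
    (complete-smallDynMonopolies d≤h)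
    (copies-smallDynMonopolies {d} {complete d} h (complete-smallDynMonopolies ≤-refl))
    where
    d≤h : d ≤ h
    d≤h = s≤s (m≤m+n k (k * k))

  dyn-upper : ∀ τ → sumF τ ≡ numEdges graph → ∃[ M ] (IsDynMonopoly graph τ M × count M ≤ D)
  dyn-upper τ sum≡edges =
    let M , monopoly , cost = small-monopolies τ
    in M , monopoly ,
       *-cancelˡ-≤ {count M} {D} d (≤-trans cost (≤-reflexive (trans sum≡edges numEdges-graph)))

  dyn-lower : ∀ M → IsDynMonopoly graph τ₀ M → D ≤ count M
  dyn-lower M monopoly = begin
    h * k                                             ≤⟨ copies-complete-vertexCover h k (M ∘ cliqueVertex) cover ⟩
    count (M ∘ cliqueVertex)                          ≤⟨ m≤n+m _ (count (M ∘ hubVertex)) ⟩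
    count (M ∘ hubVertex) + count (M ∘ cliqueVertex)  ≡⟨ count-++ h M ⟨
    count M                                           ∎
    where
    open ≤-Reasoning
    saturated : ∀ j → deg graph (cliqueVertex j) ≤ τ₀ (cliqueVertex j)
    saturated j = ≤-reflexive (trans (deg-cliqueVertex j) (sym (lookup-++ʳ τ₀-hub τ₀-cliques j)))
    cover : IsVertexCover smallCliques (M ∘ cliqueVertex)
    cover x y x~y = dynMonopoly-covers-saturated-edge monopoly
      (trans (⊕-adjʳ (complete h) smallCliques x y) x~y) (saturated x) (saturated y)

  isDynAvg : IsDynAvg graph (edgeDensity graph) D
  isDynAvg = (τ₀ , τ₀-threshold , sum≡edges⇒avg≃density τ₀ sumF-τ₀ , dyn-τ₀) , maximal
    where
    dyn-τ₀ : IsDyn graph τ₀ D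
    dyn-τ₀ = let M , monopoly , M≤D = dyn-upper τ₀ sumF-τ₀
             in (M , monopoly , ≤-antisym M≤D (dyn-lower M monopoly)) , dyn-lower
    maximal : ∀ τ k′ → IsThreshold graph τ → avgThreshold graph τ ≃ edgeDensity graph →
              IsDyn graph τ k′ → k′ ≤ D
    maximal τ k′ _ avg≃density (_ , minimal) =
      let M , monopoly , M≤D = dyn-upper τ (avg≃density⇒sum≡edges τ avg≃density)
      in ≤-trans (minimal M monopoly) M≤D

  size-graph : size graph ≡ h * suc d
  size-graph = trans (cong (_+_ h) (size-copies h (complete d))) (sym (*-suc h d))

  k≤size : k ≤ size graph
  k≤size = ≤-trans (m≤m+n k (k * k)) (≤-trans (n≤1+n _) (m≤m+n h (size smallCliques)))

  ratio : ∀ p q → q + q ℕ.< k → ∣ (+ D / size graph) - 1ℚᵘ ∣ < ℚ.mkℚᵘ ℤ.+[1+ p ] q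
  ratio p q q+q<k = ∣n/N-1∣< D (size graph) p q D≤size (begin-strict
    (size graph ∸ D) * suc q     ≡⟨ cong (λ n → (n ∸ D) * suc q) size-graph ⟩
    (h * suc d ∸ h * k) * suc q  ≡⟨ cong (_* suc q) (*-distribˡ-∸ h (suc d) k) ⟨
    h * (suc d ∸ k) * suc q      ≡⟨ *-assoc h (suc d ∸ k) (suc q) ⟩
    h * ((suc d ∸ k) * suc q)    ≡⟨ cong (λ n → h * (n * suc q)) (m+n∸n≡m 2 k) ⟩
    h * (2 * suc q)              <⟨ *-monoʳ-< h (subst (ℕ._< suc d) (sym (twice q)) (s≤s (s≤s q+q<k))) ⟩
    h * suc d                    ≡⟨ size-graph ⟨
    size graph ∎)
    where
    open ≤-Reasoning
    D≤size : D ≤ size graph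
    D≤size = ≤-trans (*-monoʳ-≤ h (≤-trans (n≤1+n k) (n≤1+n d))) (≤-reflexive (sym size-graph))
    twice : ∀ q → 2 * suc q ≡ suc (suc (q + q))
    twice = solve-∀

proposition2 : Σ (ℕ → Graph) λ G →
    Σ ((k : ℕ) → NonZero (size (G k))) λ nz →
    Σ (ℕ → ℕ) λ D →
      ((k : ℕ) → IsDynAvg (G k) {{nz k}} (edgeDensity (G k) {{nz k}}) (D k)) ×
      ((K : ℕ) → ∃[ N ] ((k : ℕ) → N ≤ k → K ≤ size (G k))) ×
      ((e : ℚᵘ) → 0ℚᵘ < e → ∃[ N ] ((k : ℕ) → N ≤ k →
        ∣ ((+ D k) / size (G k)) {{nz k}} - 1ℚᵘ ∣ < e))
proposition2 = graph , (λ _ → _) , D , isDynAvg , unbounded , converges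
  where
  open Construction
  unbounded : (K : ℕ) → ∃[ N ] ((k : ℕ) → N ≤ k → K ≤ size (graph k))
  unbounded K = K , λ k K≤k → ≤-trans K≤k (k≤size k)
  converges : (e : ℚᵘ) → 0ℚᵘ < e →
              ∃[ N ] ((k : ℕ) → N ≤ k → ∣ (+ D k / size (graph k)) - 1ℚᵘ ∣ < e)
  converges (ℚ.mkℚᵘ ℤ.+[1+ p ] q) _           = suc (q + q) , λ k q+q<k → ratio k p q q+q<k
  converges (ℚ.mkℚᵘ (+ zero) q)   (ℚ.*<* (ℤ.+<+ ()))
  converges (ℚ.mkℚᵘ ℤ.-[1+ _ ] _) (ℚ.*<* ())
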